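{- Let $k\ge 2$, $n\ge 1$, and let $\mathbf{S}\subseteq\Sigma_k^n$ be nonempty. Let $\mathbf{S}_1,\mathbf{S}_2,\ldots,\mathbf{S}_m$ be a UC-partition of $\mathbf{S}$ with universal cycles $\alpha_1,\alpha_2,\ldots,\alpha_m$ (so $\alpha_i$ is a universal cycle for $\mathbf{S}_i$), let $x$ be the last symbol of $\alpha_m$, and let $\mathcal{U}_{m,n}=\alpha_1\alpha_2\cdots\alpha_m$. Suppose that: (1) $|\alpha_m|\ge n$; (2) the length of the maximal suffix of $\alpha_m$ consisting only of the symbol $x$ is at least the length of the maximal suffix consisting only of $x$ of every $\alpha_i$, $1\le i\le m$; (3) for each $1\le i<m$, the pair $(\text{ext}_n(\alpha_i),\text{ext}_n(\alpha_{i+1}))$ is prefix-related with respect to $(x,n)$. Then $\mathcal{U}_{m,n}$ is a universal cycle for $\mathbf{S}$, and $\text{pre}_n(\mathcal{U}_{m,n})=\text{pre}_n(\text{ext}_n(\alpha_1))$.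
   Context: $\Sigma_k=\{0,1,\ldots,k-1\}$ and $\Sigma_k^n$ is the set of strings of length $n$ over $\Sigma_k$. For a nonempty $\mathbf{S}\subseteq\Sigma_k^n$, a universal cycle for $\mathbf{S}$ is a string of length $|\mathbf{S}|$ which, viewed cyclically, contains every string of $\mathbf{S}$ as a (length-$n$, possibly wrapping around) substring exactly once. A partition of $\mathbf{S}$ into subsets $\mathbf{S}_1,\ldots,\mathbf{S}_m$ is a UC-partition if each $\mathbf{S}_i$ has a universal cycle. For a string $\alpha$ of length at least $\ell$, $\text{pre}_\ell(\alpha)$ denotes its length-$\ell$ prefix; for $\ell\le 0$, $\text{pre}_\ell(\alpha)$ is the empty string. For a nonempty string $\alpha$, $\text{ext}_n(\alpha)=\alpha^t$ (concatenation of $t$ copies) where $t$ is the smallest integer with $t|\alpha|\ge n$. Prefix-related: let $\alpha=a_1\cdots a_s$, $\beta=b_1\cdots b_t$ with $s,t\ge n>0$ and $x\in\Sigma_k$; let $j$ be the smallest nonnegative integer with $a_{s-j}\ne x$ ($j=\infty$ if none). Then $(\alpha,\beta)$ is prefix-related with respect to $(x,n)$ if $j\le n$ and $\text{pre}_{n-j-1}(\alpha)=\text{pre}_{n-j-1}(\beta)$. -}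

module Defs where

open import Data.Nat using (ℕ; zero; suc; _+_; _*_; _∸_; _≤_; _<_; _≤ᵇ_)
open import Data.Bool using (Bool; true; false; if_then_else_)
open import Data.Fin using (Fin)
import Data.Fin.Properties as FinP
open import Data.List using (List; []; _∷_; _++_; length; take; drop; concat; replicate; map; upTo; filter; reverse; takeWhile)
open import Data.List.Properties using (≡-dec)
open import Data.List.Membership.Propositional using (_∈_)
open import Data.Product using (_×_)
open import Relation.Binary.PropositionalEquality using (_≡_)
open import Relation.Nullary using (Dec)

Str : ℕ → Set
Str k = List (Fin k)

_≟s_ : ∀ {k} → (u v : Str k) → Dec (u ≡ v)
_≟s_ = ≡-dec FinP._≟_

-- cyclic length-n substring of u starting at position i (wrapping around as often as needed)
window : ∀ {k} → ℕ → Str k → ℕ → Str k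
window n u i = take n (concat (replicate n (drop i u ++ take i u)))

windows : ∀ {k} → ℕ → Str k → List (Str k)
windows n u = map (window n u) (upTo (length u))

count : ∀ {k} → Str k → List (Str k) → ℕ
count w ws = length (filter (λ v → v ≟s w) ws)

-- A (finite) set S ⊆ Σ_k^n is represented by a duplicate-free list of strings of length n.
-- u is a universal cycle for S: |u| = |S| and every string of S occurs exactly once
-- as a cyclic length-n substring of u.
IsUC : ∀ {k} → ℕ → List (Str k) → Str k → Set
IsUC n S u = (length u ≡ length S) × (∀ w → w ∈ S → count w (windows n u) ≡ 1)

private
  search : ℕ → ℕ → ℕ → ℕ → ℕ
  search s n t zero = t
  search s n t (suc fuel) = if n ≤ᵇ t * s then t else search s n (suc t) fuel

-- number of copies t in ext_n: the smallest t with t·|α| ≥ n (for nonempty α; t ≤ n suffices)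
extCopies : ℕ → ℕ → ℕ
extCopies n s = search s n 0 (suc n)

ext : ∀ {k} → ℕ → Str k → Str k
ext n α = concat (replicate (extCopies n (length α)) α)

-- pre_ℓ(α) (ℓ ≤ 0 is handled by truncated subtraction at the use site)
pre : ∀ {k} → ℕ → Str k → Str k
pre ℓ α = take ℓ α

xSuffix : ∀ {k} → Fin k → Str k → ℕ
xSuffix x α = length (takeWhile (λ y → y FinP.≟ x) (reverse α))

-- Here j = xSuffix x α when it is < |α|
-- (j = ∞ iff α consists only of x, i.e. xSuffix x α = |α|, which violates j ≤ n).
-- pre_{n-j-1} with n-j-1 ≤ 0 is the empty string, matching ℕ truncated subtraction.
PrefixRelated : ∀ {k} → Fin k → ℕ → Str k → Str k → Set
PrefixRelated x n α β =
  (0 < n) × (n ≤ length α) × (n ≤ length β) ×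
  (xSuffix x α < length α) × (xSuffix x α ≤ n) ×
  (pre (n ∸ xSuffix x α ∸ 1) α ≡ pre (n ∸ xSuffix x α ∸ 1) β)

module Submission where

-- A cyclic string u is studied through its infinite periodic reading
-- cyc u s = u[s mod |u|]; its cyclic windows are then simply
-- cycWindow n u i = [cyc u (i+l) | l < n], i < |u|.  Let α end in the run
-- x^j and β end in (at least) x^j, with |β| ≥ n, and suppose the first
-- n-j-1 symbols of β agree with α^∞.  Then the windows of α β split into
-- four blocks -- starting inside α before its final run, inside that run,
-- inside β before its final run, inside that run -- which coincide with
-- the corresponding blocks of the windows of α and of β, except that the two
-- x-runs trade places.  Hence windows(αβ) is a permutation of
-- windows(α) ++ windows(β), and αβ starts like α^∞ (module Join).
-- joinTwo derives the hypotheses of Join from prefix-relatedness, and joining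
-- α₀,…,αₘ from the right by induction (joined) shows that the windows of
-- α₀⋯αₘ are a permutation of those of the αᵢ, hence of S.

open import Defs
open import Data.Nat using (ℕ; zero; suc; _+_; _*_; _∸_; _≤_; _<_; _≥_; _≤ᵇ_; z≤n; s≤s; s≤s⁻¹)
open import Data.Nat.Properties
open import Data.Nat.DivMod using (_%_; m<n⇒m%n≡m; [m+n]%n≡m%n)
open import Data.Nat.Tactic.RingSolver using (solve-∀)
open import Data.Bool using (true)
open import Data.Fin using (Fin; zero; suc; fromℕ; inject₁)
import Data.Fin.Properties as FinP
open import Data.List using (List; []; _∷_; _++_; length; take; drop; concat; replicate; applyUpTo; upTo; reverse; takeWhile; tabulate; last)
open import Data.List.Properties using (length-++; length-take; length-drop; length-replicate; length-applyUpTo; length-map; length-upTo; length-reverse; map-upTo; reverse-++; reverse-involutive; ++-identityʳ; ++-assoc)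
open import Data.List.Relation.Unary.All using (All; []; _∷_) renaming (lookup to All-lookup)
open import Data.List.Relation.Unary.Any using (here; there)
open import Data.List.Relation.Unary.Unique.Propositional using (Unique)
open import Data.List.Relation.Unary.AllPairs using ([]; _∷_)
open import Data.List.Membership.Propositional using (_∈_)
open import Data.List.Membership.Propositional.Properties using (∈-∃++)
open import Data.List.Relation.Binary.Permutation.Propositional using (_↭_; ↭-trans; ↭-refl; ↭-reflexive; prep)
open import Data.List.Relation.Binary.Permutation.Propositional.Properties using (++⁺; ++⁺ˡ; ++-comm; shift; shifts; filter-↭; ↭-length)
open import Data.Maybe using (just)
open import Data.Product using (∃; _×_; _,_; proj₁; proj₂)
open import Data.Sum using (_⊎_; inj₁; inj₂)
open import Data.Empty using (⊥-elim)
open import Relation.Nullary using (yes; no)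
open import Relation.Binary.PropositionalEquality

below-or-past : ∀ a s → s < a ⊎ ∃ λ r → s ≡ a + r
below-or-past zero    s       = inj₂ (s , refl)
below-or-past (suc a) zero    = inj₁ (s≤s z≤n)
below-or-past (suc a) (suc s) with below-or-past a s
... | inj₁ s<a       = inj₁ (s≤s s<a)
... | inj₂ (r , eq)  = inj₂ (r , cong suc eq)

periodic-ext : ∀ {A : Set} a → 1 ≤ a → (f g : ℕ → A) →
               (∀ s → f (a + s) ≡ f s) → (∀ s → g (a + s) ≡ g s) →
               (∀ s → s < a → f s ≡ g s) → ∀ s → f s ≡ g s
periodic-ext a 1≤a f g f-per g-per base s = go (suc s) s ≤-refl
  where
  go : ∀ fuel s → s < fuel → f s ≡ g s
  go (suc fuel) s s<fuel with below-or-past a s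
  ... | inj₁ s<a          = base s s<a
  ... | inj₂ (r , refl)   =
    trans (f-per r) (trans (go fuel r (≤-trans (+-monoˡ-≤ r 1≤a) (s≤s⁻¹ s<fuel))) (sym (g-per r)))

applyUpTo-cong : ∀ {A : Set} (f g : ℕ → A) m → (∀ i → i < m → f i ≡ g i) → applyUpTo f m ≡ applyUpTo g m
applyUpTo-cong f g zero    _ = refl
applyUpTo-cong f g (suc m) h =
  cong₂ _∷_ (h 0 (s≤s z≤n)) (applyUpTo-cong (λ i → f (suc i)) (λ i → g (suc i)) m (λ i lt → h (suc i) (s≤s lt)))

applyUpTo-+ : ∀ {A : Set} (f : ℕ → A) m₁ m₂ → applyUpTo f (m₁ + m₂) ≡ applyUpTo f m₁ ++ applyUpTo (λ i → f (m₁ + i)) m₂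
applyUpTo-+ f zero     m₂ = refl
applyUpTo-+ f (suc m₁) m₂ = cong (f 0 ∷_) (applyUpTo-+ (λ i → f (suc i)) m₁ m₂)

length-take-≤ : ∀ {A : Set} m (u : List A) → m ≤ length u → length (take m u) ≡ m
length-take-≤ m u m≤ = trans (length-take m u) (m≤n⇒m⊓n≡m m≤)

length-repeat : ∀ {A : Set} t (u : List A) → length (concat (replicate t u)) ≡ t * length u
length-repeat zero    u = refl
length-repeat (suc t) u = trans (length-++ u) (cong (length u +_) (length-repeat t u))

rotate : ∀ {A : Set} → ℕ → List A → List A
rotate i u = drop i u ++ take i u

length-rotate : ∀ {A : Set} i (u : List A) → i ≤ length u → length (rotate i u) ≡ length u
length-rotate i u i≤u = begin
  length (drop i u ++ take i u)          ≡⟨ length-++ (drop i u) ⟩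
  length (drop i u) + length (take i u)  ≡⟨ cong₂ _+_ (length-drop i u) (length-take-≤ i u i≤u) ⟩
  (length u ∸ i) + i                     ≡⟨ m∸n+n≡m i≤u ⟩
  length u                               ∎
  where open ≡-Reasoning

module _ {A : Set} (d : A) where

  -- The symbol at position i, or the default d beyond the end.
  nth : List A → ℕ → A
  nth []      _       = d
  nth (c ∷ u) zero    = c
  nth (c ∷ u) (suc i) = nth u i

  nth-++ˡ : ∀ u v i → i < length u → nth (u ++ v) i ≡ nth u i
  nth-++ˡ (c ∷ u) v zero    _         = refl
  nth-++ˡ (c ∷ u) v (suc i) (s≤s lt) = nth-++ˡ u v i lt

  nth-++ʳ : ∀ u v i → nth (u ++ v) (length u + i) ≡ nth v i
  nth-++ʳ []      v i = refl
  nth-++ʳ (c ∷ u) v i = nth-++ʳ u v i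

  nth-take : ∀ m u i → i < m → nth (take m u) i ≡ nth u i
  nth-take (suc m) []      i       _        = refl
  nth-take (suc m) (c ∷ u) zero    _        = refl
  nth-take (suc m) (c ∷ u) (suc i) (s≤s lt) = nth-take m u i lt

  nth-drop : ∀ m u i → nth (drop m u) i ≡ nth u (m + i)
  nth-drop zero    u       i = refl
  nth-drop (suc m) []      i = refl
  nth-drop (suc m) (c ∷ u) i = nth-drop m u i

  nth-replicate : ∀ m (y : A) i → i < m → nth (replicate m y) i ≡ y
  nth-replicate (suc m) y zero    _        = refl
  nth-replicate (suc m) y (suc i) (s≤s lt) = nth-replicate m y i lt

  nth-applyUpTo : ∀ (f : ℕ → A) m i → i < m → nth (applyUpTo f m) i ≡ f i
  nth-applyUpTo f (suc m) zero    _        = refl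
  nth-applyUpTo f (suc m) (suc i) (s≤s lt) = nth-applyUpTo (λ i → f (suc i)) m i lt

  nth-ext : ∀ u v → length u ≡ length v → (∀ i → i < length u → nth u i ≡ nth v i) → u ≡ v
  nth-ext []      []      _  _ = refl
  nth-ext (c ∷ u) (c' ∷ v) eq h =
    cong₂ _∷_ (h 0 (s≤s z≤n)) (nth-ext u v (suc-injective eq) (λ i lt → h (suc i) (s≤s lt)))

  -- Position s of the infinite periodic word u u u ⋯ (d everywhere if u = []).
  cyc : List A → ℕ → A
  cyc []      s = d
  cyc (c ∷ u) s = nth (c ∷ u) (s % suc (length u))

  cyc-< : ∀ u s → s < length u → cyc u s ≡ nth u s
  cyc-< (c ∷ u) s lt = cong (nth (c ∷ u)) (m<n⇒m%n≡m lt)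

  cyc-period : ∀ u s → cyc u (length u + s) ≡ cyc u s
  cyc-period []      s = refl
  cyc-period (c ∷ u) s =
    cong (nth (c ∷ u)) (trans (cong (_% suc (length u)) (+-comm (suc (length u)) s)) ([m+n]%n≡m%n s (suc (length u))))

  nth-repeat : ∀ t u s → s < length (concat (replicate t u)) → nth (concat (replicate t u)) s ≡ cyc u s
  nth-repeat (suc t) u s lt with below-or-past (length u) s
  ... | inj₁ s<u = trans (nth-++ˡ u _ s s<u) (sym (cyc-< u s s<u))
  ... | inj₂ (r , refl) =
    trans (nth-++ʳ u _ r)
      (trans (nth-repeat t u r (+-cancelˡ-< (length u) _ _ (subst (length u + r <_) (length-++ u) lt)))
             (sym (cyc-period u r)))

  cyc-rotate : ∀ i u → i < length u → ∀ l → cyc (rotate i u) l ≡ cyc u (i + l)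
  cyc-rotate i u i<u =
    periodic-ext (length u) (≤-trans (s≤s z≤n) i<u) (cyc (rotate i u)) (λ l → cyc u (i + l))
      rotate-period shifted-period one-period
    where
    i≤u : i ≤ length u
    i≤u = <⇒≤ i<u
    rotate-period : ∀ s → cyc (rotate i u) (length u + s) ≡ cyc (rotate i u) s
    rotate-period s = subst (λ z → cyc (rotate i u) (z + s) ≡ cyc (rotate i u) s)
                            (length-rotate i u i≤u) (cyc-period (rotate i u) s)
    shifted-period : ∀ s → cyc u (i + (length u + s)) ≡ cyc u (i + s)
    shifted-period s = trans (cong (cyc u) (swap-offsets i (length u) s)) (cyc-period u (i + s))
      where swap-offsets : ∀ i a s → i + (a + s) ≡ a + (i + s)
            swap-offsets = solve-∀
    |drop| : length (drop i u) ≡ length u ∸ i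
    |drop| = length-drop i u
    i+|drop| : i + (length u ∸ i) ≡ length u
    i+|drop| = m+[n∸m]≡n i≤u
    one-period : ∀ l → l < length u → cyc (rotate i u) l ≡ cyc u (i + l)
    one-period l l<u with below-or-past (length (drop i u)) l
    ... | inj₁ l<drop =
      trans (cyc-< (rotate i u) l (subst (l <_) (sym (length-rotate i u i≤u)) l<u))
        (trans (nth-++ˡ (drop i u) _ l l<drop) (trans (nth-drop i u l)
          (sym (cyc-< u (i + l) (subst (i + l <_) i+|drop| (+-monoʳ-< i (subst (l <_) |drop| l<drop)))))))
    ... | inj₂ (r , refl) =
      trans (cyc-< (rotate i u) _ (subst (length (drop i u) + r <_) (sym (length-rotate i u i≤u)) l<u))
        (trans (nth-++ʳ (drop i u) _ r) (trans (nth-take i u r r<i)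
          (sym (trans (cong (cyc u) (trans (sym (+-assoc i _ r)) (cong (_+ r) (trans (cong (i +_) |drop|) i+|drop|))))
                      (trans (cyc-period u r) (cyc-< u r (<-trans r<i i<u)))))))
      where
      r<i : r < i
      r<i = +-cancelˡ-< (length u ∸ i) r i
              (subst₂ _<_ (cong (_+ r) |drop|) (trans (sym i+|drop|) (+-comm i _)) l<u)

cycWindow : ∀ {k} → Fin k → ℕ → Str k → ℕ → Str k
cycWindow d n u i = applyUpTo (λ l → cyc d u (i + l)) n

window≡cycWindow : ∀ {k} (d : Fin k) n u i → i < length u → window n u i ≡ cycWindow d n u i
window≡cycWindow d n u i i<u =
  nth-ext d _ _ (trans |take| (sym (length-applyUpTo _ n))) agree
  where
  u^n : Str _
  u^n = concat (replicate n (rotate i u))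
  n≤u^n : n ≤ length u^n
  n≤u^n = subst (n ≤_) (sym (trans (length-repeat n (rotate i u)) (cong (n *_) (length-rotate i u (<⇒≤ i<u)))))
                (subst (_≤ n * length u) (*-identityʳ n) (*-monoʳ-≤ n (≤-trans (s≤s z≤n) i<u)))
  |take| : length (take n u^n) ≡ n
  |take| = length-take-≤ n u^n n≤u^n
  agree : ∀ l → l < length (take n u^n) → nth d (take n u^n) l ≡ nth d (cycWindow d n u i) l
  agree l l<take = begin
    nth d (take n u^n) l   ≡⟨ nth-take d n u^n l l<n ⟩
    nth d u^n l            ≡⟨ nth-repeat d n (rotate i u) l (<-≤-trans l<n n≤u^n) ⟩
    cyc d (rotate i u) l   ≡⟨ cyc-rotate d i u i<u l ⟩
    cyc d u (i + l)        ≡⟨ sym (nth-applyUpTo d _ n l l<n) ⟩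
    nth d (cycWindow d n u i) l ∎
    where open ≡-Reasoning
          l<n = subst (l <_) |take| l<take

windows≡cycWindows : ∀ {k} (d : Fin k) n u → windows n u ≡ applyUpTo (cycWindow d n u) (length u)
windows≡cycWindows d n u =
  trans (map-upTo (window n u) (length u)) (applyUpTo-cong _ _ (length u) (window≡cycWindow d n u))

length-windows : ∀ {k} n (u : Str k) → length (windows n u) ≡ length u
length-windows n u = trans (length-map (window n u) (upTo (length u))) (length-upTo (length u))

module _ {k : ℕ} (x : Fin k) where

  run : Str k → Str k
  run r = takeWhile (λ y → y FinP.≟ x) r

  replicate-++ : ∀ a b → replicate a x ++ replicate b x ≡ replicate (a + b) x
  replicate-++ zero    b = refl
  replicate-++ (suc a) b = cong (x ∷_) (replicate-++ a b)

  reverse-replicate : ∀ m → reverse (replicate m x) ≡ replicate m x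
  reverse-replicate zero    = refl
  reverse-replicate (suc m) = begin
    reverse (x ∷ replicate m x)              ≡⟨ reverse-++ (x ∷ []) (replicate m x) ⟩
    reverse (replicate m x) ++ (x ∷ [])      ≡⟨ cong (_++ (x ∷ [])) (reverse-replicate m) ⟩
    replicate m x ++ replicate 1 x           ≡⟨ replicate-++ m 1 ⟩
    replicate (m + 1) x                      ≡⟨ cong (λ z → replicate z x) (+-comm m 1) ⟩
    replicate (suc m) x                      ∎
    where open ≡-Reasoning

  run-decomp : ∀ r → ∃ λ δ → r ≡ replicate (length (run r)) x ++ δ
  run-decomp [] = [] , refl
  run-decomp (y ∷ r) with y FinP.≟ x
  ... | yes refl = let (δ , eq) = run-decomp r in δ , cong (y ∷_) eq
  ... | no _     = y ∷ r , refl

  run-≤ : ∀ r → length (run r) ≤ length r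
  run-≤ [] = z≤n
  run-≤ (y ∷ r) with y FinP.≟ x
  ... | yes _ = s≤s (run-≤ r)
  ... | no _  = z≤n

  run-++-≥ : ∀ r s → length (run r) ≤ length (run (r ++ s))
  run-++-≥ [] s = z≤n
  run-++-≥ (y ∷ r) s with y FinP.≟ x
  ... | yes _ = s≤s (run-++-≥ r s)
  ... | no _  = z≤n

  run-++-< : ∀ r s → length (run r) < length r → run (r ++ s) ≡ run r
  run-++-< (y ∷ r) s lt with y FinP.≟ x
  ... | yes _ = cong (y ∷_) (run-++-< r s (s≤s⁻¹ lt))
  ... | no _  = refl

  run-replicate : ∀ m → run (replicate m x) ≡ replicate m x
  run-replicate zero = refl
  run-replicate (suc m) with x FinP.≟ x
  ... | yes _ = cong (x ∷_) (run-replicate m)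
  ... | no x≢x = ⊥-elim (x≢x refl)

  xSuffix-decomp : ∀ u → ∃ λ γ → u ≡ γ ++ replicate (xSuffix x u) x
  xSuffix-decomp u =
    let (δ , eq) = run-decomp (reverse u) in
    reverse δ , (begin
      u                                                     ≡⟨ sym (reverse-involutive u) ⟩
      reverse (reverse u)                                   ≡⟨ cong reverse eq ⟩
      reverse (replicate (xSuffix x u) x ++ δ)              ≡⟨ reverse-++ (replicate (xSuffix x u) x) δ ⟩
      reverse δ ++ reverse (replicate (xSuffix x u) x)      ≡⟨ cong (reverse δ ++_) (reverse-replicate _) ⟩
      reverse δ ++ replicate (xSuffix x u) x                ∎)
    where open ≡-Reasoning

  ends-with-run : ∀ u j → j ≤ xSuffix x u → ∃ λ δ → u ≡ δ ++ replicate j x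
  ends-with-run u j j≤ with xSuffix-decomp u
  ... | γ , eq = γ ++ replicate (xSuffix x u ∸ j) x , (begin
    u                                                                ≡⟨ eq ⟩
    γ ++ replicate (xSuffix x u) x                                   ≡⟨ cong (λ z → γ ++ replicate z x) (sym (m∸n+n≡m j≤)) ⟩
    γ ++ replicate (xSuffix x u ∸ j + j) x                           ≡⟨ cong (γ ++_) (sym (replicate-++ (xSuffix x u ∸ j) j)) ⟩
    γ ++ (replicate (xSuffix x u ∸ j) x ++ replicate j x)            ≡⟨ sym (++-assoc γ _ _) ⟩
    (γ ++ replicate (xSuffix x u ∸ j) x) ++ replicate j x            ∎)
    where open ≡-Reasoning

  xSuffix-≤ : ∀ u → xSuffix x u ≤ length u
  xSuffix-≤ u = subst (xSuffix x u ≤_) (length-reverse u) (run-≤ (reverse u))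

  xSuffix-++-≥ : ∀ u v → xSuffix x v ≤ xSuffix x (u ++ v)
  xSuffix-++-≥ u v = subst (λ z → xSuffix x v ≤ length (run z)) (sym (reverse-++ u v)) (run-++-≥ (reverse v) (reverse u))

  xSuffix-++ : ∀ u v → xSuffix x v < length v → xSuffix x (u ++ v) ≡ xSuffix x v
  xSuffix-++ u v lt = cong length (trans (cong run (reverse-++ u v))
    (run-++-< (reverse v) (reverse u) (subst (xSuffix x v <_) (sym (length-reverse v)) lt)))

  xSuffix-replicate : ∀ m → xSuffix x (replicate m x) ≡ m
  xSuffix-replicate m = begin
    length (run (reverse (replicate m x)))   ≡⟨ cong (λ z → length (run z)) (reverse-replicate m) ⟩
    length (run (replicate m x))             ≡⟨ cong length (run-replicate m) ⟩
    length (replicate m x)                   ≡⟨ length-replicate m ⟩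
    m                                        ∎
    where open ≡-Reasoning

  all-x : ∀ u → xSuffix x u ≡ length u → u ≡ replicate (length u) x
  all-x u eq with xSuffix-decomp u
  ... | [] , e = trans e (cong (λ z → replicate z x) eq)
  ... | c ∷ γ , e = ⊥-elim (<-irrefl eq (subst (xSuffix x u <_) (sym (cong length e)) run<))
    where
    run< : xSuffix x u < length ((c ∷ γ) ++ replicate (xSuffix x u) x)
    run< = subst (xSuffix x u <_) (sym (length-++ (c ∷ γ)))
             (s≤s (subst (λ z → xSuffix x u ≤ length γ + z) (sym (length-replicate (xSuffix x u))) (m≤n+m _ (length γ))))

  repeat-replicate : ∀ t a → concat (replicate t (replicate a x)) ≡ replicate (t * a) x
  repeat-replicate zero    a = refl
  repeat-replicate (suc t) a = trans (cong (replicate a x ++_) (repeat-replicate t a)) (replicate-++ a (t * a))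

extCopies-long : ∀ n b → suc n ≤ b → extCopies (suc n) b ≡ 1
extCopies-long n b le with suc n ≤ᵇ 1 * b | ≤⇒≤ᵇ (subst (suc n ≤_) (sym (*-identityˡ b)) le)
... | true | _ = refl

ext-long : ∀ {k} n (u : Str k) → 1 ≤ n → n ≤ length u → ext n u ≡ u
ext-long (suc n) u _ le = trans (cong (λ t → concat (replicate t u)) (extCopies-long n (length u) le)) (++-identityʳ u)

repeat-snoc : ∀ {A : Set} t (u : List A) → concat (replicate (suc t) u) ≡ concat (replicate t u) ++ u
repeat-snoc zero    u = ++-identityʳ u
repeat-snoc (suc t) u = trans (cong (u ++_) (repeat-snoc t u)) (sym (++-assoc u (concat (replicate t u)) u))

xSuffix-repeat : ∀ {k} (x : Fin k) t (u : Str k) →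
                 xSuffix x (concat (replicate t u)) < length (concat (replicate t u)) →
                 (xSuffix x u < length u) × (xSuffix x (concat (replicate t u)) ≡ xSuffix x u)
xSuffix-repeat x zero    u ()
xSuffix-repeat x (suc t) u lt with m≤n⇒m<n∨m≡n (xSuffix-≤ x u)
... | inj₁ u-not-all-x = u-not-all-x , trans (cong (xSuffix x) (repeat-snoc t u)) (xSuffix-++ x (concat (replicate t u)) u u-not-all-x)
... | inj₂ u-all-x     = ⊥-elim (<-irrefl power-all-x lt)
  where
  u^ x^ : Str _
  u^ = concat (replicate (suc t) u)
  x^ = replicate (suc t * length u) x
  u^≡x^ : u^ ≡ x^
  u^≡x^ = trans (cong (λ z → concat (replicate (suc t) z)) (all-x x u u-all-x)) (repeat-replicate x (suc t) (length u))
  power-all-x : xSuffix x u^ ≡ length u^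
  power-all-x = begin
    xSuffix x u^   ≡⟨ cong (xSuffix x) u^≡x^ ⟩
    xSuffix x x^   ≡⟨ xSuffix-replicate x _ ⟩
    suc t * length u ≡⟨ sym (length-replicate _) ⟩
    length x^      ≡⟨ cong length (sym u^≡x^) ⟩
    length u^      ∎
    where open ≡-Reasoning

offset-< : ∀ {i l j t} → i < j → i + l ≡ j + t → t < l
offset-< {i} {l} {j} {t} i<j eq = +-cancelˡ-< j t l (subst (_< j + l) eq (+-monoˡ-< l i<j))

below-truncated : ∀ r j n → suc r + j < n → r < n ∸ j ∸ 1
below-truncated r j n h =
  subst (r <_) (sym (∸-+-assoc n j 1)) (m+n≤o⇒m≤o∸n (suc r) (subst (_≤ n) (regroup r j) h))
  where regroup : ∀ r j → suc (suc r + j) ≡ suc r + (j + 1)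
        regroup = solve-∀

exchange-blocks : ∀ {A : Set} (A₁ A₂ B₁ B₂ : List A) → A₁ ++ (B₂ ++ (B₁ ++ A₂)) ↭ (A₁ ++ A₂) ++ (B₁ ++ B₂)
exchange-blocks A₁ A₂ B₁ B₂ =
  subst (A₁ ++ (B₂ ++ (B₁ ++ A₂)) ↭_) (sym (++-assoc A₁ A₂ (B₁ ++ B₂)))
    (++⁺ˡ A₁ (↭-trans (++-comm B₂ (B₁ ++ A₂))
                      (subst (_↭ A₂ ++ (B₁ ++ B₂)) (sym (++-assoc B₁ A₂ B₂)) (shifts B₁ A₂))))

module Join {k : ℕ} (x : Fin k) (n j : ℕ) (α β γ δ : Str k)
            (α≡ : α ≡ γ ++ replicate j x) (β≡ : β ≡ δ ++ replicate j x) (n≤β : n ≤ length β)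
            (β-starts-like-α∞ : ∀ r → suc r + j < n → nth x β r ≡ cyc x α r) where

  g f a b : ℕ
  g = length γ
  f = length δ
  a = length α
  b = length β

  |α| : a ≡ g + j
  |α| = trans (cong length α≡) (trans (length-++ γ) (cong (g +_) (length-replicate j)))

  |β| : b ≡ f + j
  |β| = trans (cong length β≡) (trans (length-++ δ) (cong (f +_) (length-replicate j)))

  |αβ| : length (α ++ β) ≡ a + b
  |αβ| = length-++ α

  run-α : ∀ s → s < j → nth x α (g + s) ≡ x
  run-α s s<j = trans (cong (λ z → nth x z (g + s)) α≡) (trans (nth-++ʳ x γ _ s) (nth-replicate x j x s s<j))

  run-β : ∀ s → s < j → nth x β (f + s) ≡ x
  run-β s s<j = trans (cong (λ z → nth x z (f + s)) β≡) (trans (nth-++ʳ x δ _ s) (nth-replicate x j x s s<j))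

  αβ∞ α∞ β∞ : ℕ → Fin k
  αβ∞ = cyc x (α ++ β)
  α∞  = cyc x α
  β∞  = cyc x β

  αβ∞-α : ∀ t → t < a → αβ∞ t ≡ nth x α t
  αβ∞-α t t<a = trans (cyc-< x (α ++ β) t (subst (t <_) (sym |αβ|) (<-≤-trans t<a (m≤m+n a b)))) (nth-++ˡ x α β t t<a)

  αβ∞-β : ∀ r → r < b → αβ∞ (a + r) ≡ nth x β r
  αβ∞-β r r<b = trans (cyc-< x (α ++ β) (a + r) (subst (a + r <_) (sym |αβ|) (+-monoʳ-< a r<b))) (nth-++ʳ x α β r)

  αβ∞-period : ∀ r → αβ∞ (a + b + r) ≡ αβ∞ r
  αβ∞-period r = trans (cong (λ z → αβ∞ (z + r)) (sym |αβ|)) (cyc-period x (α ++ β) r)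

  short-<b : ∀ r → suc r + j < n → r < b
  short-<b r h = <-≤-trans (<-trans (m≤m+n (suc r) j) h) n≤β

  αβ∞-follows-α∞ : ∀ t → suc t + j < a + n → αβ∞ t ≡ α∞ t
  αβ∞-follows-α∞ t h with below-or-past a t
  ... | inj₁ t<a = trans (αβ∞-α t t<a) (sym (cyc-< x α t t<a))
  ... | inj₂ (r , refl) =
    trans (αβ∞-β r (short-<b r h')) (trans (β-starts-like-α∞ r h') (sym (cyc-period x α r)))
    where
    regroup : ∀ a r j → suc (a + r) + j ≡ a + (suc r + j)
    regroup = solve-∀
    h' : suc r + j < n
    h' = +-cancelˡ-< a _ _ (subst (_< a + n) (regroup a r j) h)

  αβ∞-starts-like-β : ∀ r → suc r + j < n → αβ∞ r ≡ nth x β r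
  αβ∞-starts-like-β r h with below-or-past a r
  ... | inj₁ r<a = trans (αβ∞-α r r<a) (trans (sym (cyc-< x α r r<a)) (sym (β-starts-like-α∞ r h)))
  ... | inj₂ (r' , refl) =
    trans (αβ∞-β r' (short-<b r' h'))
      (trans (β-starts-like-α∞ r' h') (trans (sym (cyc-period x α r')) (sym (β-starts-like-α∞ (a + r') h))))
    where
    h' : suc r' + j < n
    h' = ≤-<-trans (+-monoˡ-≤ j (s≤s (m≤n+m r' a))) h

  W : Str k → ℕ → Str k
  W = cycWindow x n

  block-α-head : ∀ i → i < g → W (α ++ β) i ≡ W α i
  block-α-head i i<g = applyUpTo-cong _ _ n (λ l l<n → αβ∞-follows-α∞ (i + l) (bound l l<n))
    where
    regroup : ∀ i l j → (suc i + j) + l ≡ suc (i + l) + j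
    regroup = solve-∀
    bound : ∀ l → l < n → suc (i + l) + j < a + n
    bound l l<n = subst₂ _<_ (regroup i l j) (cong (_+ n) (sym |α|)) (+-mono-≤-< (+-monoˡ-≤ j i<g) l<n)

  block-α-run : ∀ i → i < j → W (α ++ β) (g + i) ≡ W β (f + i)
  block-α-run i i<j = applyUpTo-cong _ _ n pointwise
    where
    pointwise : ∀ l → l < n → αβ∞ (g + i + l) ≡ β∞ (f + i + l)
    pointwise l l<n with below-or-past j (i + l)
    ... | inj₁ il<j = begin
      αβ∞ (g + i + l)          ≡⟨ cong αβ∞ (+-assoc g i l) ⟩
      αβ∞ (g + (i + l))        ≡⟨ αβ∞-α _ (subst (g + (i + l) <_) (sym |α|) (+-monoʳ-< g il<j)) ⟩
      nth x α (g + (i + l))    ≡⟨ run-α (i + l) il<j ⟩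
      x                        ≡⟨ sym (run-β (i + l) il<j) ⟩
      nth x β (f + (i + l))    ≡⟨ sym (cyc-< x β _ (subst (f + (i + l) <_) (sym |β|) (+-monoʳ-< f il<j))) ⟩
      β∞ (f + (i + l))         ≡⟨ cong β∞ (sym (+-assoc f i l)) ⟩
      β∞ (f + i + l)           ∎
      where open ≡-Reasoning
    ... | inj₂ (r , il≡jr) = begin
      αβ∞ (g + i + l)          ≡⟨ cong αβ∞ (trans (past-run g) (cong (_+ r) (sym |α|))) ⟩
      αβ∞ (a + r)              ≡⟨ αβ∞-β r r<b ⟩
      nth x β r                ≡⟨ sym (cyc-< x β r r<b) ⟩
      β∞ r                     ≡⟨ sym (cyc-period x β r) ⟩
      β∞ (b + r)               ≡⟨ cong β∞ (trans (cong (_+ r) |β|) (sym (past-run f))) ⟩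
      β∞ (f + i + l)           ∎
      where
      open ≡-Reasoning
      past-run : ∀ c → c + i + l ≡ c + j + r
      past-run c = trans (+-assoc c i l) (trans (cong (c +_) il≡jr) (sym (+-assoc c j r)))
      r<b : r < b
      r<b = <-≤-trans (<-trans (offset-< i<j il≡jr) l<n) n≤β

  block-β-head : ∀ i → i < f → W (α ++ β) (g + (j + i)) ≡ W β i
  block-β-head i i<f = applyUpTo-cong _ _ n pointwise
    where
    regroup : ∀ g j i l → g + (j + i) + l ≡ (g + j) + (i + l)
    regroup = solve-∀
    into-β : ∀ l → g + (j + i) + l ≡ a + (i + l)
    into-β l = trans (regroup g j i l) (cong (_+ (i + l)) (sym |α|))
    pointwise : ∀ l → l < n → αβ∞ (g + (j + i) + l) ≡ β∞ (i + l)
    pointwise l l<n with below-or-past b (i + l)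
    ... | inj₁ il<b = trans (cong αβ∞ (into-β l)) (trans (αβ∞-β _ il<b) (sym (cyc-< x β _ il<b)))
    ... | inj₂ (r , il≡br) = begin
      αβ∞ (g + (j + i) + l)    ≡⟨ cong αβ∞ (trans (into-β l) (trans (cong (a +_) il≡br) (sym (+-assoc a b r)))) ⟩
      αβ∞ (a + b + r)          ≡⟨ αβ∞-period r ⟩
      αβ∞ r                    ≡⟨ αβ∞-starts-like-β r short ⟩
      nth x β r                ≡⟨ sym (cyc-< x β r (short-<b r short)) ⟩
      β∞ r                     ≡⟨ sym (cyc-period x β r) ⟩
      β∞ (b + r)               ≡⟨ cong β∞ (sym il≡br) ⟩
      β∞ (i + l)               ∎
      where
      open ≡-Reasoning
      -- i + l = f + j + r with i < f forces j + r < l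
      gap : j + r < l
      gap = +-cancelˡ-< f (j + r) l
              (subst (_< f + l) (trans il≡br (trans (cong (_+ r) |β|) (+-assoc f j r))) (+-monoˡ-< l i<f))
      short : suc r + j < n
      short = ≤-<-trans (subst (_≤ l) (cong suc (+-comm j r)) gap) l<n

  slack : ∀ t l → t < l → l < n → suc t + j < a + n
  slack t l t<l l<n = begin-strict
    suc t + j    ≤⟨ +-monoˡ-≤ j t<l ⟩
    l + j        <⟨ +-monoˡ-< j l<n ⟩
    n + j        ≡⟨ +-comm n j ⟩
    j + n        ≤⟨ m≤n+m (j + n) g ⟩
    g + (j + n)  ≡⟨ sym (+-assoc g j n) ⟩
    g + j + n    ≡⟨ cong (_+ n) (sym |α|) ⟩
    a + n        ∎
    where open ≤-Reasoning

  block-β-run : ∀ i → i < j → W (α ++ β) (g + (j + (f + i))) ≡ W α (g + i)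
  block-β-run i i<j = applyUpTo-cong _ _ n pointwise
    where
    regroup : ∀ g j f i l → g + (j + (f + i)) + l ≡ (g + j) + (f + (i + l))
    regroup = solve-∀
    into-β : ∀ l → g + (j + (f + i)) + l ≡ a + (f + (i + l))
    into-β l = trans (regroup g j f i l) (cong (_+ (f + (i + l))) (sym |α|))
    pointwise : ∀ l → l < n → αβ∞ (g + (j + (f + i)) + l) ≡ α∞ (g + i + l)
    pointwise l l<n with below-or-past j (i + l)
    ... | inj₁ il<j = begin
      αβ∞ (g + (j + (f + i)) + l) ≡⟨ cong αβ∞ (into-β l) ⟩
      αβ∞ (a + (f + (i + l)))  ≡⟨ αβ∞-β _ (subst (f + (i + l) <_) (sym |β|) (+-monoʳ-< f il<j)) ⟩
      nth x β (f + (i + l))    ≡⟨ run-β (i + l) il<j ⟩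
      x                        ≡⟨ sym (run-α (i + l) il<j) ⟩
      nth x α (g + (i + l))    ≡⟨ sym (cyc-< x α _ (subst (g + (i + l) <_) (sym |α|) (+-monoʳ-< g il<j))) ⟩
      α∞ (g + (i + l))         ≡⟨ cong α∞ (sym (+-assoc g i l)) ⟩
      α∞ (g + i + l)           ∎
      where open ≡-Reasoning
    ... | inj₂ (t , il≡jt) = begin
      αβ∞ (g + (j + (f + i)) + l) ≡⟨ cong αβ∞ (trans (into-β l) wrap) ⟩
      αβ∞ (a + b + t)          ≡⟨ αβ∞-period t ⟩
      αβ∞ t                    ≡⟨ αβ∞-follows-α∞ t (slack t l (offset-< i<j il≡jt) l<n) ⟩
      α∞ t                     ≡⟨ sym (cyc-period x α t) ⟩
      α∞ (a + t)               ≡⟨ cong α∞ (trans (cong (_+ t) |α|) (sym past-run)) ⟩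
      α∞ (g + i + l)           ∎
      where
      open ≡-Reasoning
      past-run : g + i + l ≡ g + j + t
      past-run = trans (+-assoc g i l) (trans (cong (g +_) il≡jt) (sym (+-assoc g j t)))
      wrap : a + (f + (i + l)) ≡ a + b + t
      wrap = trans (cong (λ z → a + (f + z)) il≡jt)
               (trans (cong (a +_) (trans (sym (+-assoc f j t)) (cong (_+ t) (sym |β|)))) (sym (+-assoc a b t)))

  -- windows(αβ) = A₁ B₂ B₁ A₂ whereas windows(α) = A₁ A₂ and windows(β) = B₁ B₂.
  windows-join : windows n (α ++ β) ↭ windows n α ++ windows n β
  windows-join = subst₂ _↭_ (sym split-αβ) (sym (cong₂ _++_ split-α split-β)) (exchange-blocks A₁ A₂ B₁ B₂)
    where
    A₁ A₂ B₁ B₂ : List (Str k)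
    A₁ = applyUpTo (W α) g
    A₂ = applyUpTo (λ i → W α (g + i)) j
    B₁ = applyUpTo (W β) f
    B₂ = applyUpTo (λ i → W β (f + i)) j
    G : ℕ → Str k
    G = W (α ++ β)
    split-α : windows n α ≡ A₁ ++ A₂
    split-α = trans (windows≡cycWindows x n α) (trans (cong (applyUpTo (W α)) |α|) (applyUpTo-+ (W α) g j))
    split-β : windows n β ≡ B₁ ++ B₂
    split-β = trans (windows≡cycWindows x n β) (trans (cong (applyUpTo (W β)) |β|) (applyUpTo-+ (W β) f j))
    split-αβ : windows n (α ++ β) ≡ A₁ ++ (B₂ ++ (B₁ ++ A₂))
    split-αβ = begin
      windows n (α ++ β)
        ≡⟨ windows≡cycWindows x n (α ++ β) ⟩
      applyUpTo G (length (α ++ β))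
        ≡⟨ cong (applyUpTo G) (trans |αβ| (trans (cong₂ _+_ |α| |β|) (+-assoc g j (f + j)))) ⟩
      applyUpTo G (g + (j + (f + j)))
        ≡⟨ applyUpTo-+ G g (j + (f + j)) ⟩
      applyUpTo G g ++ applyUpTo (λ i → G (g + i)) (j + (f + j))
        ≡⟨ cong (applyUpTo G g ++_) (applyUpTo-+ (λ i → G (g + i)) j (f + j)) ⟩
      applyUpTo G g ++ (applyUpTo (λ i → G (g + i)) j ++ applyUpTo (λ i → G (g + (j + i))) (f + j))
        ≡⟨ cong (λ z → applyUpTo G g ++ (applyUpTo (λ i → G (g + i)) j ++ z)) (applyUpTo-+ (λ i → G (g + (j + i))) f j) ⟩
      applyUpTo G g ++ (applyUpTo (λ i → G (g + i)) j ++ (applyUpTo (λ i → G (g + (j + i))) f ++ applyUpTo (λ i → G (g + (j + (f + i)))) j))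
        ≡⟨ cong₂ _++_ (applyUpTo-cong _ _ g block-α-head)
             (cong₂ _++_ (applyUpTo-cong _ _ j block-α-run)
               (cong₂ _++_ (applyUpTo-cong _ _ f block-β-head) (applyUpTo-cong _ _ j block-β-run))) ⟩
      A₁ ++ (B₂ ++ (B₁ ++ A₂))
        ∎
      where open ≡-Reasoning

  prefix-join : 1 ≤ g → ∀ t → n ≤ length (concat (replicate t α)) → take n (α ++ β) ≡ take n (concat (replicate t α))
  prefix-join 1≤g t n≤α^t = nth-ext x _ _ (trans |take-αβ| (sym |take-α^t|)) agree
    where
    α^t : Str k
    α^t = concat (replicate t α)
    |take-αβ| : length (take n (α ++ β)) ≡ n
    |take-αβ| = length-take-≤ n (α ++ β) (subst (n ≤_) (sym |αβ|) (≤-trans n≤β (m≤n+m b a)))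
    |take-α^t| : length (take n α^t) ≡ n
    |take-α^t| = length-take-≤ n α^t n≤α^t
    regroup : ∀ r j → suc r + j ≡ (1 + j) + r
    regroup = solve-∀
    αβ-follows-α∞ : ∀ r → r < n → nth x (α ++ β) r ≡ α∞ r
    αβ-follows-α∞ r r<n with below-or-past a r
    ... | inj₁ r<a = trans (nth-++ˡ x α β r r<a) (sym (cyc-< x α r r<a))
    ... | inj₂ (r' , refl) = trans (nth-++ʳ x α β r') (trans (β-starts-like-α∞ r' short) (sym (cyc-period x α r')))
      where
      short : suc r' + j < n
      short = ≤-<-trans (subst₂ _≤_ (sym (regroup r' j)) (cong (_+ r') (sym |α|)) (+-monoˡ-≤ r' (+-monoˡ-≤ j 1≤g))) r<n
    agree : ∀ r → r < length (take n (α ++ β)) → nth x (take n (α ++ β)) r ≡ nth x (take n α^t) r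
    agree r r<take = begin
      nth x (take n (α ++ β)) r ≡⟨ nth-take x n (α ++ β) r r<n ⟩
      nth x (α ++ β) r          ≡⟨ αβ-follows-α∞ r r<n ⟩
      α∞ r                      ≡⟨ sym (nth-repeat x t α r (<-≤-trans r<n n≤α^t)) ⟩
      nth x α^t r               ≡⟨ sym (nth-take x n α^t r r<n) ⟩
      nth x (take n α^t) r      ∎
      where open ≡-Reasoning
            r<n = subst (r <_) |take-αβ| r<take

joinTwo : ∀ {k} (x : Fin k) n → 1 ≤ n → (α β ε : Str k) →
          PrefixRelated x n (ext n α) ε → pre n β ≡ pre n ε → n ≤ length β →
          xSuffix x α ≤ xSuffix x β →
          (windows n (α ++ β) ↭ windows n α ++ windows n β) × (pre n (α ++ β) ≡ pre n (ext n α))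
joinTwo x n 1≤n α β ε (_ , n≤E , _ , E-not-all-x , _ , E≈ε) β≈ε n≤β runs =
  Join.windows-join x n j α β γ δ α≡ β≡ n≤β β-starts-like-α∞ ,
  Join.prefix-join x n j α β γ δ α≡ β≡ n≤β β-starts-like-α∞ 1≤γ c n≤E
  where
  c j : ℕ
  c = extCopies n (length α)
  j = xSuffix x α
  E γ δ : Str _
  E = ext n α
  γ = proj₁ (xSuffix-decomp x α)
  δ = proj₁ (ends-with-run x β j runs)
  α≡ : α ≡ γ ++ replicate j x
  α≡ = proj₂ (xSuffix-decomp x α)
  β≡ : β ≡ δ ++ replicate j x
  β≡ = proj₂ (ends-with-run x β j runs)
  α-facts : (j < length α) × (xSuffix x E ≡ j)
  α-facts = xSuffix-repeat x c α E-not-all-x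
  -- α is not a power of x, so the part γ before its final run is nonempty
  1≤γ : 1 ≤ length γ
  1≤γ = +-cancelʳ-≤ j 1 (length γ)
          (subst (suc j ≤_) (trans (cong length α≡) (trans (length-++ γ) (cong (length γ +_) (length-replicate j))))
                 (proj₁ α-facts))
  β-starts-like-α∞ : ∀ r → suc r + j < n → nth x β r ≡ cyc x α r
  β-starts-like-α∞ r h = begin
    nth x β r            ≡⟨ sym (nth-take x n β r r<n) ⟩
    nth x (take n β) r   ≡⟨ cong (λ z → nth x z r) β≈ε ⟩
    nth x (take n ε) r   ≡⟨ nth-take x n ε r r<n ⟩
    nth x ε r            ≡⟨ sym (nth-take x L ε r r<L) ⟩
    nth x (take L ε) r   ≡⟨ cong (λ z → nth x z r) (sym E≈ε) ⟩
    nth x (take L E) r   ≡⟨ nth-take x L E r r<L ⟩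
    nth x E r            ≡⟨ nth-repeat x c α r (<-≤-trans r<n n≤E) ⟩
    cyc x α r            ∎
    where
    open ≡-Reasoning
    L : ℕ
    L = n ∸ xSuffix x E ∸ 1
    r<n : r < n
    r<n = <-trans (m≤m+n (suc r) j) h
    r<L : r < L
    r<L = subst (λ z → r < n ∸ z ∸ 1) (sym (proj₂ α-facts)) (below-truncated r j n h)

record Joined {k} (x : Fin k) (n m : ℕ) (α : Fin (suc m) → Str k) : Set where
  field
    windows-↭ : windows n (concat (tabulate α)) ↭ concat (tabulate (λ i → windows n (α i)))
    prefix    : pre n (concat (tabulate α)) ≡ pre n (ext n (α zero))
    long      : n ≤ length (concat (tabulate α))
    final-run : xSuffix x (α (fromℕ m)) ≤ xSuffix x (concat (tabulate α))

joined : ∀ {k} (x : Fin k) n → 1 ≤ n → ∀ m (α : Fin (suc m) → Str k) →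
         n ≤ length (α (fromℕ m)) →
         (∀ i → xSuffix x (α i) ≤ xSuffix x (α (fromℕ m))) →
         (∀ (i : Fin m) → PrefixRelated x n (ext n (α (inject₁ i))) (ext n (α (suc i)))) →
         Joined x n m α
joined x n 1≤n zero α long _ _ = record
  { windows-↭ = ↭-reflexive (trans (cong (windows n) α₀++[]) (sym (++-identityʳ _)))
  ; prefix    = trans (cong (pre n) α₀++[]) (cong (pre n) (sym (ext-long n (α zero) 1≤n long)))
  ; long      = subst (n ≤_) (cong length (sym α₀++[])) long
  ; final-run = ≤-reflexive (cong (xSuffix x) (sym α₀++[]))
  }
  where α₀++[] : α zero ++ [] ≡ α zero
        α₀++[] = ++-identityʳ (α zero)
joined x n 1≤n (suc m) α long runs related = record
  { windows-↭ = ↭-trans (proj₁ step) (++⁺ˡ (windows n (α zero)) (Joined.windows-↭ rest))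
  ; prefix    = proj₂ step
  ; long      = subst (n ≤_) (sym (length-++ (α zero))) (≤-trans (Joined.long rest) (m≤n+m _ _))
  ; final-run = ≤-trans (Joined.final-run rest) (xSuffix-++-≥ x (α zero) _)
  }
  where
  rest : Joined x n m (λ i → α (suc i))
  rest = joined x n 1≤n m (λ i → α (suc i)) long (λ i → runs (suc i)) (λ i → related (suc i))
  step : (windows n (α zero ++ concat (tabulate (λ i → α (suc i))))
            ↭ windows n (α zero) ++ windows n (concat (tabulate (λ i → α (suc i)))))
         × (pre n (α zero ++ concat (tabulate (λ i → α (suc i)))) ≡ pre n (ext n (α zero)))
  step = joinTwo x n 1≤n (α zero) (concat (tabulate (λ i → α (suc i)))) (ext n (α (suc zero)))
           (related zero) (Joined.prefix rest) (Joined.long rest) (≤-trans (runs zero) (Joined.final-run rest))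

module _ {k : ℕ} where

  count-↭ : ∀ (w : Str k) {ws vs} → ws ↭ vs → count w ws ≡ count w vs
  count-↭ w p = ↭-length (filter-↭ (λ v → v ≟s w) p)

  count-≢ : ∀ (w v : Str k) ws → v ≢ w → count w (v ∷ ws) ≡ count w ws
  count-≢ w v ws v≢w with v ≟s w
  ... | yes v≡w = ⊥-elim (v≢w v≡w)
  ... | no _    = refl

  count-≡ : ∀ (w : Str k) ws → count w (w ∷ ws) ≡ suc (count w ws)
  count-≡ w ws with w ≟s w
  ... | yes _  = refl
  ... | no w≢w = ⊥-elim (w≢w refl)

  count-absent : ∀ (w : Str k) ws → All (λ v → w ≢ v) ws → count w ws ≡ 0
  count-absent w []       []       = refl
  count-absent w (v ∷ ws) (w≢v ∷ ps) = trans (count-≢ w v ws (λ v≡w → w≢v (sym v≡w))) (count-absent w ws ps)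

  count≡1⇒∈ : ∀ (w : Str k) ws → count w ws ≡ 1 → w ∈ ws
  count≡1⇒∈ w (v ∷ ws) h with v ≟s w
  ... | yes refl = here refl
  ... | no _     = there (count≡1⇒∈ w ws h)

  unique⇒count≡1 : ∀ {w : Str k} {ws} → Unique ws → w ∈ ws → count w ws ≡ 1
  unique⇒count≡1 {w} {_ ∷ ws} (fresh ∷ _) (here refl) = trans (count-≡ w ws) (cong suc (count-absent w ws fresh))
  unique⇒count≡1 {w} {v ∷ ws} (fresh ∷ u) (there w∈) = trans (count-≢ w v ws (All-lookup fresh w∈)) (unique⇒count≡1 u w∈)

  count-once-↭ : ∀ (ws P : List (Str k)) → Unique P → length ws ≡ length P → (∀ w → w ∈ P → count w ws ≡ 1) → ws ↭ P
  count-once-↭ []       []      _ _  _ = ↭-refl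
  count-once-↭ (_ ∷ _)  []      _ () _
  count-once-↭ ws       (p ∷ P) (fresh ∷ uP) len once with ∈-∃++ (count≡1⇒∈ p ws (once p (here refl)))
  ... | ws₁ , ws₂ , refl = ↭-trans moved (prep p (count-once-↭ (ws₁ ++ ws₂) P uP len' once'))
    where
    moved : ws₁ ++ (p ∷ ws₂) ↭ p ∷ (ws₁ ++ ws₂)
    moved = shift p ws₁ ws₂
    len' : length (ws₁ ++ ws₂) ≡ length P
    len' = suc-injective (trans (sym (↭-length moved)) len)
    once' : ∀ w → w ∈ P → count w (ws₁ ++ ws₂) ≡ 1
    once' w w∈ = trans (sym (count-≢ w p (ws₁ ++ ws₂) (All-lookup fresh w∈))) (trans (sym (count-↭ w moved)) (once w (there w∈)))

  concat-tabulate-↭ : ∀ m (F G : Fin m → List (Str k)) → (∀ i → F i ↭ G i) → concat (tabulate F) ↭ concat (tabulate G)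
  concat-tabulate-↭ zero    F G p = ↭-refl
  concat-tabulate-↭ (suc m) F G p = ++⁺ (p zero) (concat-tabulate-↭ m (λ i → F (suc i)) (λ i → G (suc i)) (λ i → p (suc i)))

ucWindows-↭ : ∀ {k} n (P : List (Str k)) u → Unique P → IsUC n P u → windows n u ↭ P
ucWindows-↭ n P u uP (|u| , once) = count-once-↭ (windows n u) P uP (trans (length-windows n u) |u|) once

-- The theorem: join all cycles, then count.
corollary1 : (k n m : ℕ) → k ≥ 2 → n ≥ 1 →
    (S : List (Str k)) → Unique S → All (λ w → length w ≡ n) S → S ≢ [] →
    (parts : Fin (suc m) → List (Str k)) →
    (∀ i → Unique (parts i)) → (∀ i → parts i ≢ []) →
    concat (tabulate parts) ↭ S →
    (α : Fin (suc m) → Str k) → (∀ i → IsUC n (parts i) (α i)) →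
    (x : Fin k) → last (α (fromℕ m)) ≡ just x →
    length (α (fromℕ m)) ≥ n →
    (∀ i → xSuffix x (α i) ≤ xSuffix x (α (fromℕ m))) →
    (∀ (i : Fin m) → PrefixRelated x n (ext n (α (inject₁ i))) (ext n (α (suc i)))) →
    IsUC n S (concat (tabulate α)) × (pre n (concat (tabulate α)) ≡ pre n (ext n (α zero)))
corollary1 k n m _ 1≤n S uS _ _ parts uparts _ parts↭S α ucs x _ long runs related =
  (|U| , once) , Joined.prefix all-joined
  where
  U : Str k
  U = concat (tabulate α)
  all-joined : Joined x n m α
  all-joined = joined x n 1≤n m α long runs related
  windows-U : windows n U ↭ S
  windows-U = ↭-trans (Joined.windows-↭ all-joined)
                (↭-trans (concat-tabulate-↭ (suc m) _ _ (λ i → ucWindows-↭ n (parts i) (α i) (uparts i) (ucs i))) parts↭S)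
  |U| : length U ≡ length S
  |U| = trans (sym (length-windows n U)) (↭-length windows-U)
  once : ∀ w → w ∈ S → count w (windows n U) ≡ 1
  once w w∈S = trans (count-↭ w windows-U) (unique⇒count≡1 uS w∈S)
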